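{- Let $K=C_m\oplus C_m$ with $m\ge4$, let $g\in K$, let $f_1,f_2\in K$, and suppose $S=f_1^{m-1}f_2^{m-1}(f_1+f_2)\in\Upsilon_{nu}(K)$. (1) If $S'=f_1^{ -2}S(f_1+g)(f_1-g)\in\Upsilon_{nu}(K)$, then $g=0$, and hence $S=S'$. (2) If $S'=f_2^{ -2}S(f_2+g)(f_2-g)\in\Upsilon_{nu}(K)$, then $g=0$, and hence $S=S'$. (3) If $S'=f_1^{ -1}f_2^{ -1}S(f_1+g)(f_2-g)\in\Upsilon_{nu}(K)$, then $g\in\{0,-f_1+f_2\}$, and hence $S=S'$. (4) If $S'=f_1^{ -1}(f_1+f_2)^{ -1}S(f_1+g)(f_1+f_2-g)\in\Upsilon_{nu}(K)$, then $g\in\{0,f_2\}$, and hence $S=S'$. (5) If $S'=f_2^{ -1}(f_1+f_2)^{ -1}S(f_2+g)(f_1+f_2-g)\in\Upsilon_{nu}(K)$, then $g\in\{0,f_1\}$, and hence $S=S'$.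
   Context: A sequence over an abelian group $K$ is a finite unordered sequence of elements of $K$, i.e. an element of the free abelian monoid on $K$, written multiplicatively ($h^k$ is $k$ copies of $h$; products are concatenations). For a subsequence $T$ of $S$, $T^{ -1}S$ denotes $S$ with the terms of $T$ removed; e.g. $f_1^{ -2}S(f_1+g)(f_1-g)$ is obtained from $S$ by removing two copies of $f_1$ and adding $f_1+g$ and $f_1-g$. A minimal zero-sum sequence is a nonempty sequence with sum $0$ having no nonempty proper subsequence with sum $0$. $\Upsilon(K)$ is the set of minimal zero-sum sequences $S$ over $K=C_m\oplus C_m$ for which there exist a basis $(e_1,e_2)$ of $K$ (i.e. $K=\langle e_1\rangle\oplus\langle e_2\rangle$, $e_1,e_2\ne0$) and integers $y_1,\dots,y_m\in[0,m-1]$ with $y_1+\dots+y_m\equiv1\pmod m$ such that $S=e_1^{m-1}\prod_{\nu=1}^m(y_\nu e_1+e_2)$. $\Upsilon_u(K)$ is the set of $S\in\Upsilon(K)$ having a unique element of multiplicity $m-1$, and $\Upsilon_{nu}(K)=\Upsilon(K)\setminus\Upsilon_u(K)$. -}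

module Defs where

open import Data.Nat using (ℕ; zero; suc; _+_; _∸_; _<_; NonZero)
open import Data.Nat.DivMod using (_mod_)
open import Data.Fin using (Fin; toℕ)
import Data.Fin.Properties as FinP
open import Data.Product using (Σ; _×_; _,_; ∃)
open import Data.Product.Properties using (≡-dec)
open import Data.List using (List; []; _∷_; _++_; replicate; map; length; foldr; allFin)
open import Data.List.Relation.Binary.Sublist.Propositional using (_⊆_)
open import Data.List.Relation.Binary.Permutation.Propositional using (_↭_)
open import Relation.Binary.PropositionalEquality using (_≡_; _≢_)
open import Relation.Nullary using (¬_; yes; no)
open import Relation.Binary.Definitions using (DecidableEquality)

module _ (m : ℕ) .{{_ : NonZero m}} where

  K : Set
  K = Fin m × Fin m

  infixl 6 _⊕_ _⊖_

  addF : Fin m → Fin m → Fin m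
  addF a b = (toℕ a + toℕ b) mod m

  negF : Fin m → Fin m
  negF a = (m ∸ toℕ a) mod m

  _⊕_ : K → K → K
  (a , b) ⊕ (c , d) = addF a c , addF b d

  ⊖_ : K → K
  ⊖ (a , b) = negF a , negF b

  _⊖_ : K → K → K
  x ⊖ y = x ⊕ (⊖ y)

  0K : K
  0K = (0 mod m) , (0 mod m)

  _·_ : ℕ → K → K
  zero · x = 0K
  suc n · x = x ⊕ (n · x)

  _≟K_ : DecidableEquality K
  _≟K_ = ≡-dec FinP._≟_ FinP._≟_

  -- Sequences over K: lists considered up to permutation (_↭_).
  Seq : Set
  Seq = List K

  σ : Seq → K
  σ = foldr _⊕_ 0K

  mult : K → Seq → ℕ
  mult h [] = 0
  mult h (x ∷ xs) with h ≟K x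
  ... | yes _ = suc (mult h xs)
  ... | no  _ = mult h xs

  MinZeroSum : Seq → Set
  MinZeroSum S = (S ≢ []) × (σ S ≡ 0K) ×
    (∀ (T : Seq) → T ⊆ S → T ≢ [] → σ T ≡ 0K → length T ≡ length S)

  IsBasis : K → K → Set
  IsBasis e₁ e₂ = (e₁ ≢ 0K) × (e₂ ≢ 0K) ×
    (∀ (x : K) → Σ ℕ λ a → Σ ℕ λ b → x ≡ (a · e₁) ⊕ (b · e₂)) ×
    (∀ (a b : ℕ) → (a · e₁) ⊕ (b · e₂) ≡ 0K → (a · e₁ ≡ 0K) × (b · e₂ ≡ 0K))

  sumF : ∀ {n} → (Fin n → ℕ) → ℕ
  sumF {n} y = foldr _+_ 0 (map y (allFin n))

  Υ : Seq → Set
  Υ S = MinZeroSum S ×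
    (Σ K λ e₁ → Σ K λ e₂ → Σ (Fin m → ℕ) λ y →
       IsBasis e₁ e₂ ×
       (∀ ν → y ν < m) ×
       (sumF y mod m ≡ 1 mod m) ×
       (S ↭ (replicate (m ∸ 1) e₁ ++ map (λ ν → (y ν · e₁) ⊕ e₂) (allFin m))))

  Υu : Seq → Set
  Υu S = Υ S × (Σ K λ h → (mult h S ≡ m ∸ 1) × (∀ h' → mult h' S ≡ m ∸ 1 → h' ≡ h))

  Υnu : Seq → Set
  Υnu S = Υ S × ¬ Υu S

  S₀ : K → K → Seq
  S₀ f₁ f₂ = replicate (m ∸ 1) f₁ ++ replicate (m ∸ 1) f₂ ++ ((f₁ ⊕ f₂) ∷ [])

  S₁ : K → K → K → Seq
  S₁ g f₁ f₂ = replicate (m ∸ 3) f₁ ++ replicate (m ∸ 1) f₂ ++ ((f₁ ⊕ f₂) ∷ (f₁ ⊕ g) ∷ (f₁ ⊖ g) ∷ [])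

  S₂ : K → K → K → Seq
  S₂ g f₁ f₂ = replicate (m ∸ 1) f₁ ++ replicate (m ∸ 3) f₂ ++ ((f₁ ⊕ f₂) ∷ (f₂ ⊕ g) ∷ (f₂ ⊖ g) ∷ [])

  S₃ : K → K → K → Seq
  S₃ g f₁ f₂ = replicate (m ∸ 2) f₁ ++ replicate (m ∸ 2) f₂ ++ ((f₁ ⊕ f₂) ∷ (f₁ ⊕ g) ∷ (f₂ ⊖ g) ∷ [])

  S₄ : K → K → K → Seq
  S₄ g f₁ f₂ = replicate (m ∸ 2) f₁ ++ replicate (m ∸ 1) f₂ ++ ((f₁ ⊕ g) ∷ ((f₁ ⊕ f₂) ⊖ g) ∷ [])

  S₅ : K → K → K → Seq
  S₅ g f₁ f₂ = replicate (m ∸ 1) f₁ ++ replicate (m ∸ 2) f₂ ++ ((f₂ ⊕ g) ∷ ((f₁ ⊕ f₂) ⊖ g) ∷ [])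

{-# OPTIONS --safe #-}
module Submission where

-- Every S ∈ Υ(K) contains the basis element e₁ exactly m − 1 times, since e₁ differs from
-- every term y e₁ + e₂; so a sequence in Υnu(K) has at least two terms of multiplicity m − 1.
-- For each modified sequence S′ and each g outside the stated set, counting multiplicities
-- shows that at most one element of K (the untouched f₁ or f₂, or none at all) occurs m − 1
-- times in S′.  This uses m ≥ 4 and that the short subsequences f₁, f₂, f₁f₁, f₂f₂, f₁f₂ of the
-- minimal zero-sum sequence S are not zero-sum.  For the remaining values of g, S′ is a
-- rearrangement of S.

open import Defs
open import Level using (0ℓ)
open import Algebra.Bundles using (AbelianGroup)
open import Algebra.Structures using (IsAbelianGroup)
import Algebra.Properties.AbelianGroup as AbelianGroupProperties
import Algebra.Solver.CommutativeMonoid as CommutativeMonoidSolver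
open import Data.Nat using (ℕ; zero; suc; _+_; _∸_; _≤_; _<_; z≤n; s≤s; NonZero)
open import Data.Nat.DivMod using (_%_; _mod_; %-distribˡ-+; m%n%n≡m%n; m<n⇒m%n≡m; [m+n]%n≡m%n; m%n<n)
open import Data.Nat.Properties
  using ( +-comm; +-assoc; +-identityʳ; m+[n∸m]≡n; <⇒≤; ≤-antisym; <-irrefl; ≤-trans
        ; m≤m+n; m≤n+m; m≢1+n+m; >⇒≢; <⇒≱)
open import Data.Fin using (Fin; toℕ)
open import Data.Fin.Properties using (toℕ-fromℕ<; toℕ-injective; toℕ<n)
open import Data.Empty using (⊥-elim)
open import Data.Product using (∃; _×_; _,_; proj₁; proj₂)
open import Data.Sum using (_⊎_; inj₁; inj₂)
open import Data.List using (List; []; _∷_; _++_; replicate; map; filter; length; allFin)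
open import Data.List.Properties
  using (length-++; length-replicate; filter-++; filter-all; filter-none; length-filter; filter-complete)
open import Data.List.Relation.Unary.All using (All; []; _∷_; universal)
open import Data.List.Relation.Unary.All.Properties using (replicate⁺; all-filter; map⁺)
open import Data.List.Relation.Binary.Sublist.Propositional using (_⊆_; _∷_; _∷ʳ_; minimum)
open import Data.List.Relation.Binary.Sublist.Propositional.Properties using (++⁺ˡ)
open import Data.List.Relation.Binary.Permutation.Propositional
  using (_↭_; ↭-refl; ↭-trans; ↭-reflexive; ↭-prep; ↭-swap)
open import Data.List.Relation.Binary.Permutation.Propositional.Properties
  using (filter-↭; ↭-length; shifts; ++-commutativeMonoid)
  renaming (++⁺ˡ to ↭-++⁺ˡ)
open import Relation.Nullary using (¬_; Dec; yes; no)
open import Relation.Nullary.Decidable using (decidable-stable)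
open import Relation.Binary.Definitions using (DecidableEquality)
open import Relation.Binary.PropositionalEquality

module FinAddition (m : ℕ) .{{_ : NonZero m}} where

  toℕ-mod : ∀ n → toℕ (n mod m) ≡ n % m
  toℕ-mod n = toℕ-fromℕ< (m%n<n n m)

  [m+n%d]%d≡[m+n]%d : ∀ a b → (a + b % m) % m ≡ (a + b) % m
  [m+n%d]%d≡[m+n]%d a b = begin
    (a + b % m) % m           ≡⟨ %-distribˡ-+ a (b % m) m ⟩
    (a % m + b % m % m) % m   ≡⟨ cong (λ r → (a % m + r) % m) (m%n%n≡m%n b m) ⟩
    (a % m + b % m) % m       ≡⟨ %-distribˡ-+ a b m ⟨
    (a + b) % m               ∎
    where open ≡-Reasoning

  toℕ-addF : ∀ a b → toℕ (addF m a b) ≡ (toℕ a + toℕ b) % m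
  toℕ-addF a b = toℕ-mod (toℕ a + toℕ b)

  addF-comm : ∀ a b → addF m a b ≡ addF m b a
  addF-comm a b = cong (_mod m) (+-comm (toℕ a) (toℕ b))

  addF-assoc : ∀ a b c → addF m (addF m a b) c ≡ addF m a (addF m b c)
  addF-assoc a b c = toℕ-injective (begin
    toℕ (addF m (addF m a b) c)          ≡⟨ toℕ-addF (addF m a b) c ⟩
    (toℕ (addF m a b) + toℕ c) % m       ≡⟨ cong (λ r → (r + toℕ c) % m) (toℕ-addF a b) ⟩
    ((toℕ a + toℕ b) % m + toℕ c) % m    ≡⟨ cong (_% m) (+-comm _ (toℕ c)) ⟩
    (toℕ c + (toℕ a + toℕ b) % m) % m    ≡⟨ [m+n%d]%d≡[m+n]%d (toℕ c) _ ⟩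
    (toℕ c + (toℕ a + toℕ b)) % m        ≡⟨ cong (_% m) (trans (+-comm (toℕ c) _) (+-assoc (toℕ a) _ _)) ⟩
    (toℕ a + (toℕ b + toℕ c)) % m        ≡⟨ [m+n%d]%d≡[m+n]%d (toℕ a) _ ⟨
    (toℕ a + (toℕ b + toℕ c) % m) % m    ≡⟨ cong (λ r → (toℕ a + r) % m) (toℕ-addF b c) ⟨
    (toℕ a + toℕ (addF m b c)) % m       ≡⟨ toℕ-addF a (addF m b c) ⟨
    toℕ (addF m a (addF m b c))          ∎)
    where open ≡-Reasoning

  addF-identityʳ : ∀ a → addF m a (0 mod m) ≡ a
  addF-identityʳ a = toℕ-injective (begin
    toℕ (addF m a (0 mod m))        ≡⟨ toℕ-addF a (0 mod m) ⟩
    (toℕ a + toℕ (0 mod m)) % m     ≡⟨ cong (λ r → (toℕ a + r) % m) (toℕ-mod 0) ⟩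
    (toℕ a + 0 % m) % m             ≡⟨ [m+n%d]%d≡[m+n]%d (toℕ a) 0 ⟩
    (toℕ a + 0) % m                 ≡⟨ cong (_% m) (+-identityʳ (toℕ a)) ⟩
    toℕ a % m                       ≡⟨ m<n⇒m%n≡m (toℕ<n a) ⟩
    toℕ a                           ∎)
    where open ≡-Reasoning

  addF-inverseʳ : ∀ a → addF m a (negF m a) ≡ 0 mod m
  addF-inverseʳ a = toℕ-injective (begin
    toℕ (addF m a (negF m a))         ≡⟨ toℕ-addF a (negF m a) ⟩
    (toℕ a + toℕ (negF m a)) % m      ≡⟨ cong (λ r → (toℕ a + r) % m) (toℕ-mod (m ∸ toℕ a)) ⟩
    (toℕ a + (m ∸ toℕ a) % m) % m     ≡⟨ [m+n%d]%d≡[m+n]%d (toℕ a) _ ⟩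
    (toℕ a + (m ∸ toℕ a)) % m         ≡⟨ cong (_% m) (m+[n∸m]≡n (<⇒≤ (toℕ<n a))) ⟩
    m % m                             ≡⟨ [m+n]%n≡m%n 0 m ⟩
    0 % m                             ≡⟨ toℕ-mod 0 ⟨
    toℕ (0 mod m)                     ∎)
    where open ≡-Reasoning

module KGroup (m : ℕ) .{{_ : NonZero m}} where

  open FinAddition m

  ⊕-comm : ∀ x y → _⊕_ m x y ≡ _⊕_ m y x
  ⊕-comm (a , b) (c , d) = cong₂ _,_ (addF-comm a c) (addF-comm b d)

  ⊕-identityʳ : ∀ x → _⊕_ m x (0K m) ≡ x
  ⊕-identityʳ (a , b) = cong₂ _,_ (addF-identityʳ a) (addF-identityʳ b)

  ⊕-inverseʳ : ∀ x → _⊕_ m x (⊖_ m x) ≡ 0K m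
  ⊕-inverseʳ (a , b) = cong₂ _,_ (addF-inverseʳ a) (addF-inverseʳ b)

  ⊕-isAbelianGroup : IsAbelianGroup _≡_ (_⊕_ m) (0K m) (⊖_ m)
  ⊕-isAbelianGroup = record
    { isGroup = record
      { isMonoid = record
        { isSemigroup = record
          { isMagma = record { isEquivalence = isEquivalence ; ∙-cong = cong₂ (_⊕_ m) }
          ; assoc = λ { (a , b) (c , d) (e , f) → cong₂ _,_ (addF-assoc a c e) (addF-assoc b d f) }
          }
        ; identity = (λ x → trans (⊕-comm (0K m) x) (⊕-identityʳ x)) , ⊕-identityʳ
        }
      ; inverse = (λ x → trans (⊕-comm (⊖_ m x) x) (⊕-inverseʳ x)) , ⊕-inverseʳ
      ; ⁻¹-cong = cong (⊖_ m)
      }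
    ; comm = ⊕-comm
    }

  abelianGroup : AbelianGroup 0ℓ 0ℓ
  abelianGroup = record { isAbelianGroup = ⊕-isAbelianGroup }

  open AbelianGroup abelianGroup public
    using (_∙_; ε; _⁻¹; _-_; comm; assoc; identityˡ; identityʳ; inverseʳ)
  open AbelianGroupProperties abelianGroup public
    using ( identityʳ-unique; ⁻¹-injective; ε⁻¹≈ε; ∙-cancelˡ; y≈x\\z
          ; \\-leftDividesˡ; ⁻¹-anti-homo-\\; //-rightDividesˡ; //-rightDividesʳ; xyx⁻¹≈y)

  x≢x∙y : ∀ x {y} → y ≢ ε → x ≢ x ∙ y
  x≢x∙y x {y} y≢ε x≡x∙y = y≢ε (identityʳ-unique x y (sym x≡x∙y))

  ⁻¹-≢ε : ∀ {x} → x ≢ ε → x ⁻¹ ≢ ε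
  ⁻¹-≢ε x≢ε x⁻¹≡ε = x≢ε (⁻¹-injective (trans x⁻¹≡ε (sym ε⁻¹≈ε)))

  x-ε≡x : ∀ x → x - ε ≡ x
  x-ε≡x x = trans (cong (x ∙_) ε⁻¹≈ε) (identityʳ x)

  x≡y-g⇒x∙g≡y : ∀ {x y g} → x ≡ y - g → x ∙ g ≡ y
  x≡y-g⇒x∙g≡y {y = y} {g} x≡y-g = trans (cong (_∙ g) x≡y-g) (//-rightDividesˡ g y)

  ·-homo-+ : ∀ a b x → _·_ m (a + b) x ≡ _·_ m a x ∙ _·_ m b x
  ·-homo-+ zero    b x = sym (identityˡ _)
  ·-homo-+ (suc a) b x = trans (cong (x ∙_) (·-homo-+ a b x)) (sym (assoc x _ _))

  IsBasis⇒e₁≢y·e₁∙e₂ : ∀ {e₁ e₂} → IsBasis m e₁ e₂ → ∀ y → e₁ ≢ _·_ m y e₁ ∙ e₂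
  IsBasis⇒e₁≢y·e₁∙e₂ {e₁} {e₂} (_ , e₂≢ε , span , independent) y e₁≡ = e₂≢ε e₂≡ε
    where
    open ≡-Reasoning
    a = proj₁ (span (e₁ ⁻¹))
    b = proj₁ (proj₂ (span (e₁ ⁻¹)))
    e₁⁻¹≡ : e₁ ⁻¹ ≡ _·_ m a e₁ ∙ _·_ m b e₂
    e₁⁻¹≡ = proj₂ (proj₂ (span (e₁ ⁻¹)))
    -- expanding e₁⁻¹ in the basis shows that a · e₁ is the inverse of e₁
    [1+a]·e₁≡ε : _·_ m (suc a) e₁ ≡ ε
    [1+a]·e₁≡ε = proj₁ (independent (suc a) b (begin
      (e₁ ∙ _·_ m a e₁) ∙ _·_ m b e₂   ≡⟨ assoc e₁ _ _ ⟩
      e₁ ∙ (_·_ m a e₁ ∙ _·_ m b e₂)   ≡⟨ cong (e₁ ∙_) e₁⁻¹≡ ⟨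
      e₁ ∙ e₁ ⁻¹                       ≡⟨ inverseʳ e₁ ⟩
      ε                                ∎))
    e₂≡ε : e₂ ≡ ε
    e₂≡ε = trans (sym (identityʳ e₂)) (proj₂ (independent (a + y) 1 (begin
      _·_ m (a + y) e₁ ∙ (e₂ ∙ ε)            ≡⟨ cong₂ _∙_ (·-homo-+ a y e₁) (identityʳ e₂) ⟩
      (_·_ m a e₁ ∙ _·_ m y e₁) ∙ e₂         ≡⟨ assoc _ _ e₂ ⟩
      _·_ m a e₁ ∙ (_·_ m y e₁ ∙ e₂)         ≡⟨ cong (_·_ m a e₁ ∙_) e₁≡ ⟨
      _·_ m a e₁ ∙ e₁                        ≡⟨ comm _ e₁ ⟩
      _·_ m (suc a) e₁                       ≡⟨ [1+a]·e₁≡ε ⟩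
      ε                                      ∎)))

module _ {A : Set} where
  open CommutativeMonoidSolver (++-commutativeMonoid {A = A}) using (solve; _⊜_) renaming (_⊕_ to _⊹_)

  ↭-shiftPrefixes : ∀ (X B Y C zs : List A) {ws} → zs ++ X ++ Y ↭ ws → (X ++ B) ++ (Y ++ C) ++ zs ↭ B ++ C ++ ws
  ↭-shiftPrefixes X B Y C zs zs++X++Y↭ws = ↭-trans
    (solve 5 (λ X B Y C Z → (X ⊹ B) ⊹ (Y ⊹ C) ⊹ Z ⊜ B ⊹ C ⊹ Z ⊹ X ⊹ Y) ↭-refl X B Y C zs)
    (↭-++⁺ˡ B (↭-++⁺ˡ C zs++X++Y↭ws))

module _ {A : Set} (_≟_ : DecidableEquality A) where

  ≡-by-exclusion : ∀ {x a} (P : A → Set) → P a → ¬ x ≢ a → (x ≡ a) × P x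
  ≡-by-exclusion {x} {a} P Pa ¬x≢a = x≡a , subst P (sym x≡a) Pa
    where
    x≡a : x ≡ a
    x≡a = decidable-stable (x ≟ a) ¬x≢a

  ≡⊎≡-by-exclusion : ∀ {x a b} (P : A → Set) → P a → P b → (x ≢ a → ¬ x ≢ b) →
                     (x ≡ a ⊎ x ≡ b) × P x
  ≡⊎≡-by-exclusion {x} {a} {b} P Pa Pb excluded with x ≟ a | x ≟ b
  ... | yes refl | _        = inj₁ refl , Pa
  ... | no  _    | yes refl = inj₂ refl , Pb
  ... | no  x≢a  | no  x≢b  = ⊥-elim (excluded x≢a x≢b)

module Multiplicity (m : ℕ) .{{_ : NonZero m}} where

  open KGroup m

  mult≡length∘filter : ∀ h xs → mult m h xs ≡ length (filter (_≟K_ m h) xs)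
  mult≡length∘filter h []       = refl
  mult≡length∘filter h (x ∷ xs) with _≟K_ m h x
  ... | yes _ = cong suc (mult≡length∘filter h xs)
  ... | no  _ = mult≡length∘filter h xs

  mult-++ : ∀ h xs ys → mult m h (xs ++ ys) ≡ mult m h xs + mult m h ys
  mult-++ h xs ys = begin
    mult m h (xs ++ ys)                                   ≡⟨ mult≡length∘filter h (xs ++ ys) ⟩
    length (filter (_≟K_ m h) (xs ++ ys))                 ≡⟨ cong length (filter-++ (_≟K_ m h) xs ys) ⟩
    length (filter (_≟K_ m h) xs ++ filter (_≟K_ m h) ys) ≡⟨ length-++ (filter (_≟K_ m h) xs) ⟩
    length (filter (_≟K_ m h) xs) + length (filter (_≟K_ m h) ys)
      ≡⟨ cong₂ _+_ (mult≡length∘filter h xs) (mult≡length∘filter h ys) ⟨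
    mult m h xs + mult m h ys                             ∎
    where open ≡-Reasoning

  mult-↭ : ∀ h {xs ys} → xs ↭ ys → mult m h xs ≡ mult m h ys
  mult-↭ h {xs} {ys} xs↭ys = begin
    mult m h xs                     ≡⟨ mult≡length∘filter h xs ⟩
    length (filter (_≟K_ m h) xs)   ≡⟨ ↭-length (filter-↭ (_≟K_ m h) xs↭ys) ⟩
    length (filter (_≟K_ m h) ys)   ≡⟨ mult≡length∘filter h ys ⟨
    mult m h ys                     ∎
    where open ≡-Reasoning

  mult≤length : ∀ h xs → mult m h xs ≤ length xs
  mult≤length h xs = subst (_≤ length xs) (sym (mult≡length∘filter h xs)) (length-filter (_≟K_ m h) xs)

  mult≡0 : ∀ {h xs} → All (h ≢_) xs → mult m h xs ≡ 0
  mult≡0 {h} {xs} h∉xs = trans (mult≡length∘filter h xs) (cong length (filter-none (_≟K_ m h) h∉xs))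

  length≤mult⇒All : ∀ {h xs} → length xs ≤ mult m h xs → All (h ≡_) xs
  length≤mult⇒All {h} {xs} le =
    subst (All (h ≡_)) (filter-complete (_≟K_ m h) filter-full) (all-filter (_≟K_ m h) xs)
    where
    filter-full : length (filter (_≟K_ m h) xs) ≡ length xs
    filter-full = ≤-antisym (length-filter (_≟K_ m h) xs) (subst (length xs ≤_) (mult≡length∘filter h xs) le)

  mult-replicate-++ : ∀ n h zs → mult m h (replicate n h ++ zs) ≡ n + mult m h zs
  mult-replicate-++ n h zs = trans (mult-++ h (replicate n h) zs) (cong (_+ mult m h zs) (begin
    mult m h (replicate n h)                      ≡⟨ mult≡length∘filter h (replicate n h) ⟩
    length (filter (_≟K_ m h) (replicate n h))    ≡⟨ cong length (filter-all (_≟K_ m h) (replicate⁺ n refl)) ⟩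
    length (replicate n h)                        ≡⟨ length-replicate n ⟩
    n                                             ∎))
    where open ≡-Reasoning

  mult-replicate-≢-++ : ∀ {h x} n zs → h ≢ x → mult m h (replicate n x ++ zs) ≡ mult m h zs
  mult-replicate-≢-++ {h} {x} n zs h≢x =
    trans (mult-++ h (replicate n x) zs) (cong (_+ mult m h zs) (mult≡0 (replicate⁺ n h≢x)))

  mult-first-block : ∀ {h x y} a b zs → h ≡ x → h ≢ y → All (h ≢_) zs →
                     mult m h (replicate a x ++ replicate b y ++ zs) ≡ a
  mult-first-block {h} a b zs refl h≢y h∉zs = begin
    mult m h (replicate a h ++ replicate b _ ++ zs) ≡⟨ mult-replicate-++ a h _ ⟩
    a + mult m h (replicate b _ ++ zs)              ≡⟨ cong (a +_) (mult-replicate-≢-++ b zs h≢y) ⟩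
    a + mult m h zs                                 ≡⟨ cong (a +_) (mult≡0 h∉zs) ⟩
    a + 0                                           ≡⟨ +-identityʳ a ⟩
    a                                               ∎
    where open ≡-Reasoning

  mult-both-blocks : ∀ {h x y} a b zs → h ≡ x → h ≡ y →
                     mult m h (replicate a x ++ replicate b y ++ zs) ≡ a + (b + mult m h zs)
  mult-both-blocks a b zs refl refl = trans (mult-replicate-++ a _ _) (cong (a +_) (mult-replicate-++ b _ zs))

  mult-other-blocks : ∀ {h x y} a b zs → h ≢ x → h ≢ y →
                      mult m h (replicate a x ++ replicate b y ++ zs) ≡ mult m h zs
  mult-other-blocks a b zs h≢x h≢y = trans (mult-replicate-≢-++ a _ h≢x) (mult-replicate-≢-++ b zs h≢y)

  mult-other-blocks≡n⇒All : ∀ {h x y n} a b zs → h ≢ x → h ≢ y → length zs ≤ n →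
                            mult m h (replicate a x ++ replicate b y ++ zs) ≡ n → All (h ≡_) zs
  mult-other-blocks≡n⇒All a b zs h≢x h≢y zs≤n mult≡n =
    length≤mult⇒All (subst (length zs ≤_) (trans (sym mult≡n) (mult-other-blocks a b zs h≢x h≢y)) zs≤n)

  Υ⇒∃mult≡m∸1 : ∀ {S} → Υ m S → ∃ λ e → mult m e S ≡ m ∸ 1
  Υ⇒∃mult≡m∸1 {S} (_ , e₁ , e₂ , y , basis , _ , _ , S↭) = e₁ , (begin
    mult m e₁ S                                        ≡⟨ mult-↭ e₁ S↭ ⟩
    mult m e₁ (replicate (m ∸ 1) e₁ ++ map f (allFin m)) ≡⟨ mult-replicate-++ (m ∸ 1) e₁ _ ⟩
    (m ∸ 1) + mult m e₁ (map f (allFin m))             ≡⟨ cong ((m ∸ 1) +_) (mult≡0 e₁∉f) ⟩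
    (m ∸ 1) + 0                                        ≡⟨ +-identityʳ (m ∸ 1) ⟩
    m ∸ 1                                              ∎)
    where
    open ≡-Reasoning
    f : Fin m → K m
    f ν = _·_ m (y ν) e₁ ∙ e₂
    e₁∉f : All (e₁ ≢_) (map f (allFin m))
    e₁∉f = map⁺ (universal (λ ν → IsBasis⇒e₁≢y·e₁∙e₂ basis (y ν)) (allFin m))

  OnlyTermOfMult : ℕ → K m → Seq m → Set
  OnlyTermOfMult n p S = ∀ h → mult m h S ≡ n → h ≡ p

  OnlyTermOfMult-resp-↭ : ∀ {n p xs ys} → xs ↭ ys → OnlyTermOfMult n p ys → OnlyTermOfMult n p xs
  OnlyTermOfMult-resp-↭ xs↭ys only h mult≡n = only h (trans (sym (mult-↭ h xs↭ys)) mult≡n)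

  OnlyTermOfMult-intro : ∀ {n p S} → (∀ h → h ≢ p → mult m h S ≢ n) → OnlyTermOfMult n p S
  OnlyTermOfMult-intro {p = p} mult≢n h mult≡n = decidable-stable (_≟K_ m h p) (λ h≢p → mult≢n h h≢p mult≡n)

  Υnu⇒¬OnlyTermOfMult : ∀ {S} → Υnu m S → ∀ p → ¬ OnlyTermOfMult (m ∸ 1) p S
  Υnu⇒¬OnlyTermOfMult (υ , ¬υu) p only with Υ⇒∃mult≡m∸1 υ
  ... | e , mult-e = ¬υu (υ , e , mult-e , λ h mult-h → trans (only h mult-h) (sym (only e mult-e)))

  MinZeroSum⇒σ≢ε : ∀ {S T} → MinZeroSum m S → T ⊆ S → T ≢ [] → length T < length S → σ m T ≢ ε
  MinZeroSum⇒σ≢ε (_ , _ , minimal) T⊆S T≢[] T<S σT≡ε = <-irrefl (minimal _ T⊆S T≢[] σT≡ε) T<S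

module Modifications (k : ℕ) where

  -- With m = 4 + k the multiplicities m ∸ 1, m ∸ 2, m ∸ 3 in S₀, …, S₅ compute to 3 + k, 2 + k, 1 + k.
  m : ℕ
  m = 4 + k

  open KGroup m
  open Multiplicity m

  module MinimalS₀ {x y} (minimal : MinZeroSum m (S₀ m x y)) where

    x≢ε : x ≢ ε
    x≢ε x≡ε = MinZeroSum⇒σ≢ε minimal (refl ∷ minimum _) (λ ()) (s≤s (s≤s z≤n))
      (trans (identityʳ x) x≡ε)

    x∙x≢ε : x ∙ x ≢ ε
    x∙x≢ε x∙x≡ε = MinZeroSum⇒σ≢ε minimal (refl ∷ refl ∷ minimum _) (λ ()) (s≤s (s≤s (s≤s z≤n)))
      (trans (cong (x ∙_) (identityʳ x)) x∙x≡ε)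

    y≢ε : y ≢ ε
    y≢ε y≡ε = MinZeroSum⇒σ≢ε minimal (x ∷ʳ x ∷ʳ x ∷ʳ ++⁺ˡ (replicate k x) (refl ∷ minimum _)) (λ ())
      (s≤s (s≤s z≤n)) (trans (identityʳ y) y≡ε)

    y∙y≢ε : y ∙ y ≢ ε
    y∙y≢ε y∙y≡ε = MinZeroSum⇒σ≢ε minimal (x ∷ʳ x ∷ʳ x ∷ʳ ++⁺ˡ (replicate k x) (refl ∷ refl ∷ minimum _)) (λ ())
      (s≤s (s≤s (s≤s z≤n))) (trans (cong (y ∙_) (identityʳ y)) y∙y≡ε)

    x∙y≢ε : x ∙ y ≢ ε
    x∙y≢ε x∙y≡ε = MinZeroSum⇒σ≢ε minimal (refl ∷ x ∷ʳ x ∷ʳ ++⁺ˡ (replicate k x) (refl ∷ minimum _)) (λ ())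
      (s≤s (s≤s (s≤s z≤n))) (trans (cong (x ∙_) (identityʳ y)) x∙y≡ε)

  S₁-onlyTermOfMult : ∀ {g x y} → y ≢ ε → y ∙ y ≢ ε → g ≢ ε → OnlyTermOfMult (3 + k) y (S₁ m g x y)
  S₁-onlyTermOfMult {g} {x} {y} y≢ε y∙y≢ε g≢ε = OnlyTermOfMult-intro λ h h≢y → by-cases h h≢y (_≟K_ m h x)
    where
    by-cases : ∀ h → h ≢ y → Dec (h ≡ x) → mult m h (S₁ m g x y) ≢ 3 + k
    by-cases h h≢y (yes h≡x) mult≡ =
      m≢1+n+m (suc k) {1} (trans (sym (mult-first-block (suc k) (3 + k) _ h≡x h≢y h∉tail)) mult≡)
      where
      h∉tail : All (h ≢_) (x ∙ y ∷ x ∙ g ∷ x - g ∷ [])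
      h∉tail = subst (λ x → All (h ≢_) (x ∙ y ∷ x ∙ g ∷ x - g ∷ [])) h≡x
                 (x≢x∙y h y≢ε ∷ x≢x∙y h g≢ε ∷ x≢x∙y h (⁻¹-≢ε g≢ε) ∷ [])
    by-cases h h≢y (no h≢x) mult≡
      with mult-other-blocks≡n⇒All (suc k) (3 + k) (x ∙ y ∷ x ∙ g ∷ x - g ∷ []) h≢x h≢y (m≤m+n 3 k) mult≡
    ... | h≡x∙y ∷ h≡x∙g ∷ h≡x-g ∷ [] = y∙y≢ε (begin
      y ∙ y       ≡⟨ cong₂ _∙_ y≡g (trans y≡g g≡g⁻¹) ⟩
      g ∙ g ⁻¹    ≡⟨ inverseʳ g ⟩
      ε           ∎)
      where
      open ≡-Reasoning
      y≡g : y ≡ g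
      y≡g = ∙-cancelˡ x y g (trans (sym h≡x∙y) h≡x∙g)
      g≡g⁻¹ : g ≡ g ⁻¹
      g≡g⁻¹ = ∙-cancelˡ x g (g ⁻¹) (trans (sym h≡x∙g) h≡x-g)

  3+k<[2+k]+[2+k+t] : ∀ t → 3 + k < (2 + k) + ((2 + k) + t)
  3+k<[2+k]+[2+k+t] t = s≤s (s≤s (≤-trans (s≤s (s≤s (m≤m+n k t))) (m≤n+m _ k)))

  S₃-mult≢3+k : ∀ {g x y} → x ≢ ε → y ≢ ε → x ∙ y ≢ ε → g ≢ ε → g ≢ x ⁻¹ ∙ y →
              ∀ h → mult m h (S₃ m g x y) ≢ 3 + k
  S₃-mult≢3+k {g} {x} {y} x≢ε y≢ε x∙y≢ε g≢ε g≢x⁻¹∙y h = by-cases (_≟K_ m h x) (_≟K_ m h y)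
    where
    tail = x ∙ y ∷ x ∙ g ∷ y - g ∷ []
    by-cases : Dec (h ≡ x) → Dec (h ≡ y) → mult m h (S₃ m g x y) ≢ 3 + k
    by-cases (yes h≡x) (yes h≡y) mult≡ =
      >⇒≢ (3+k<[2+k]+[2+k+t] _) (trans (sym (mult-both-blocks (2 + k) (2 + k) tail h≡x h≡y)) mult≡)
    by-cases (yes h≡x) (no h≢y) mult≡ =
      m≢1+n+m (2 + k) {0} (trans (sym (mult-first-block (2 + k) (2 + k) tail h≡x h≢y h∉tail)) mult≡)
      where
      h∉tail : All (h ≢_) tail
      h∉tail = subst (λ h → All (h ≢_) tail) (sym h≡x)
        (x≢x∙y x y≢ε ∷ x≢x∙y x g≢ε
         ∷ (λ x≡y-g → g≢x⁻¹∙y (y≈x\\z x g y (x≡y-g⇒x∙g≡y x≡y-g))) ∷ [])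
    by-cases (no h≢x) (yes h≡y) mult≡ =
      m≢1+n+m (2 + k) {0} (trans (sym (mult-first-block (2 + k) (2 + k) tail h≡y h≢x h∉tail))
                                 (trans (sym (mult-↭ h (shifts (replicate (2 + k) x) (replicate (2 + k) y)))) mult≡))
      where
      h∉tail : All (h ≢_) tail
      h∉tail = subst (λ h → All (h ≢_) tail) (sym h≡y)
        ((λ y≡x∙y → x≢x∙y y x≢ε (trans y≡x∙y (comm x y)))
         ∷ (λ y≡x∙g → g≢x⁻¹∙y (y≈x\\z x g y (sym y≡x∙g)))
         ∷ x≢x∙y y (⁻¹-≢ε g≢ε) ∷ [])
    by-cases (no h≢x) (no h≢y) mult≡
      with mult-other-blocks≡n⇒All (2 + k) (2 + k) tail h≢x h≢y (m≤m+n 3 k) mult≡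
    ... | h≡x∙y ∷ h≡x∙g ∷ h≡y-g ∷ [] = x∙y≢ε (begin
      x ∙ y   ≡⟨ trans (sym h≡x∙y) h≡y-g ⟩
      y - g   ≡⟨ cong (y -_) (∙-cancelˡ x y g (trans (sym h≡x∙y) h≡x∙g)) ⟨
      y - y   ≡⟨ inverseʳ y ⟩
      ε       ∎)
      where open ≡-Reasoning

  S₄-onlyTermOfMult : ∀ {g x y} → g ≢ ε → g ≢ y → OnlyTermOfMult (3 + k) y (S₄ m g x y)
  S₄-onlyTermOfMult {g} {x} {y} g≢ε g≢y = OnlyTermOfMult-intro λ h h≢y → by-cases h h≢y (_≟K_ m h x)
    where
    tail = x ∙ g ∷ (x ∙ y) - g ∷ []
    by-cases : ∀ h → h ≢ y → Dec (h ≡ x) → mult m h (S₄ m g x y) ≢ 3 + k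
    by-cases h h≢y (yes h≡x) mult≡ =
      m≢1+n+m (2 + k) {0} (trans (sym (mult-first-block (2 + k) (3 + k) tail h≡x h≢y h∉tail)) mult≡)
      where
      h∉tail : All (h ≢_) tail
      h∉tail = subst (λ h → All (h ≢_) tail) (sym h≡x)
        (x≢x∙y x g≢ε ∷ (λ x≡x∙y-g → g≢y (∙-cancelˡ x g y (x≡y-g⇒x∙g≡y x≡x∙y-g))) ∷ [])
    by-cases h h≢y (no h≢x) mult≡ =
      <⇒≱ (s≤s (s≤s (s≤s z≤n)))
        (subst (_≤ 2) (trans (sym (mult-other-blocks (2 + k) (3 + k) tail h≢x h≢y)) mult≡) (mult≤length h tail))

  S₂↭S₁ : ∀ {g x y} → S₂ m g x y ↭ S₁ m g y x
  S₂↭S₁ {g} {x} {y} = ↭-trans (shifts (replicate (3 + k) x) (replicate (suc k) y))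
    (↭-reflexive (cong (λ c → replicate (suc k) y ++ replicate (3 + k) x ++ c ∷ y ∙ g ∷ y - g ∷ []) (comm x y)))

  S₅↭S₄ : ∀ {g x y} → S₅ m g x y ↭ S₄ m g y x
  S₅↭S₄ {g} {x} {y} = ↭-trans (shifts (replicate (3 + k) x) (replicate (2 + k) y))
    (↭-reflexive (cong (λ c → replicate (2 + k) y ++ replicate (3 + k) x ++ y ∙ g ∷ c - g ∷ []) (comm x y)))

  S₀↭S₁ : ∀ {x y} → S₀ m x y ↭ S₁ m ε x y
  S₀↭S₁ {x} {y} = ↭-shiftPrefixes (x ∷ x ∷ []) (replicate (suc k) x) [] (replicate (3 + k) y) (x ∙ y ∷ [])
    (↭-reflexive (cong₂ (λ u v → x ∙ y ∷ u ∷ v ∷ []) (sym (identityʳ x)) (sym (x-ε≡x x))))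

  S₀↭S₂ : ∀ {x y} → S₀ m x y ↭ S₂ m ε x y
  S₀↭S₂ {x} {y} = ↭-shiftPrefixes [] (replicate (3 + k) x) (y ∷ y ∷ []) (replicate (suc k) y) (x ∙ y ∷ [])
    (↭-reflexive (cong₂ (λ u v → x ∙ y ∷ u ∷ v ∷ []) (sym (identityʳ y)) (sym (x-ε≡x y))))

  S₀↭S₃ε : ∀ {x y} → S₀ m x y ↭ S₃ m ε x y
  S₀↭S₃ε {x} {y} = ↭-shiftPrefixes (x ∷ []) (replicate (2 + k) x) (y ∷ []) (replicate (2 + k) y) (x ∙ y ∷ [])
    (↭-reflexive (cong₂ (λ u v → x ∙ y ∷ u ∷ v ∷ []) (sym (identityʳ x)) (sym (x-ε≡x y))))

  S₀↭S₃x⁻¹∙y : ∀ {x y} → S₀ m x y ↭ S₃ m (x ⁻¹ ∙ y) x y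
  S₀↭S₃x⁻¹∙y {x} {y} = ↭-shiftPrefixes (x ∷ []) (replicate (2 + k) x) (y ∷ []) (replicate (2 + k) y) (x ∙ y ∷ [])
    (↭-prep (x ∙ y) (↭-trans (↭-swap x y ↭-refl)
      (↭-reflexive (cong₂ (λ u v → u ∷ v ∷ []) (sym (\\-leftDividesˡ x y)) (sym y-[x⁻¹∙y]≡x)))))
    where
    y-[x⁻¹∙y]≡x : y - (x ⁻¹ ∙ y) ≡ x
    y-[x⁻¹∙y]≡x = trans (cong (y ∙_) (⁻¹-anti-homo-\\ x y)) (\\-leftDividesˡ y x)

  S₀↭S₄ε : ∀ {x y} → S₀ m x y ↭ S₄ m ε x y
  S₀↭S₄ε {x} {y} = ↭-shiftPrefixes (x ∷ []) (replicate (2 + k) x) [] (replicate (3 + k) y) (x ∙ y ∷ [])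
    (↭-trans (↭-swap (x ∙ y) x ↭-refl)
      (↭-reflexive (cong₂ (λ u v → u ∷ v ∷ []) (sym (identityʳ x)) (sym (x-ε≡x (x ∙ y))))))

  S₀↭S₄y : ∀ {x y} → S₀ m x y ↭ S₄ m y x y
  S₀↭S₄y {x} {y} = ↭-shiftPrefixes (x ∷ []) (replicate (2 + k) x) [] (replicate (3 + k) y) (x ∙ y ∷ [])
    (↭-reflexive (cong (λ v → x ∙ y ∷ v ∷ []) (sym (//-rightDividesʳ y x))))

  S₀↭S₅ε : ∀ {x y} → S₀ m x y ↭ S₅ m ε x y
  S₀↭S₅ε {x} {y} = ↭-shiftPrefixes [] (replicate (3 + k) x) (y ∷ []) (replicate (2 + k) y) (x ∙ y ∷ [])
    (↭-trans (↭-swap (x ∙ y) y ↭-refl)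
      (↭-reflexive (cong₂ (λ u v → u ∷ v ∷ []) (sym (identityʳ y)) (sym (x-ε≡x (x ∙ y))))))

  S₀↭S₅x : ∀ {x y} → S₀ m x y ↭ S₅ m x x y
  S₀↭S₅x {x} {y} = ↭-shiftPrefixes [] (replicate (3 + k) x) (y ∷ []) (replicate (2 + k) y) (x ∙ y ∷ [])
    (↭-reflexive (cong₂ (λ u v → u ∷ v ∷ []) (comm x y) (sym (xyx⁻¹≈y x y))))

  Υnu-S₁⇒g≡ε : ∀ {g x y} → MinZeroSum m (S₀ m x y) → Υnu m (S₁ m g x y) → (g ≡ ε) × (S₀ m x y ↭ S₁ m g x y)
  Υnu-S₁⇒g≡ε {x = x} {y} minimal υ = ≡-by-exclusion (_≟K_ m) (λ g → S₀ m x y ↭ S₁ m g x y) S₀↭S₁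
    λ g≢ε → Υnu⇒¬OnlyTermOfMult υ y (S₁-onlyTermOfMult y≢ε y∙y≢ε g≢ε)
    where open MinimalS₀ minimal

  Υnu-S₂⇒g≡ε : ∀ {g x y} → MinZeroSum m (S₀ m x y) → Υnu m (S₂ m g x y) → (g ≡ ε) × (S₀ m x y ↭ S₂ m g x y)
  Υnu-S₂⇒g≡ε {x = x} {y} minimal υ = ≡-by-exclusion (_≟K_ m) (λ g → S₀ m x y ↭ S₂ m g x y) S₀↭S₂
    λ g≢ε → Υnu⇒¬OnlyTermOfMult υ x (OnlyTermOfMult-resp-↭ S₂↭S₁ (S₁-onlyTermOfMult x≢ε x∙x≢ε g≢ε))
    where open MinimalS₀ minimal

  Υnu-S₃⇒g≡ε⊎g≡x⁻¹∙y : ∀ {g x y} → MinZeroSum m (S₀ m x y) → Υnu m (S₃ m g x y) →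
          (g ≡ ε ⊎ g ≡ x ⁻¹ ∙ y) × (S₀ m x y ↭ S₃ m g x y)
  Υnu-S₃⇒g≡ε⊎g≡x⁻¹∙y {x = x} {y} minimal υ =
    ≡⊎≡-by-exclusion (_≟K_ m) (λ g → S₀ m x y ↭ S₃ m g x y) S₀↭S₃ε S₀↭S₃x⁻¹∙y λ g≢ε g≢x⁻¹∙y →
      Υnu⇒¬OnlyTermOfMult υ x λ h mult≡ → ⊥-elim (S₃-mult≢3+k x≢ε y≢ε x∙y≢ε g≢ε g≢x⁻¹∙y h mult≡)
    where open MinimalS₀ minimal

  Υnu-S₄⇒g≡ε⊎g≡y : ∀ {g x y} → Υnu m (S₄ m g x y) → (g ≡ ε ⊎ g ≡ y) × (S₀ m x y ↭ S₄ m g x y)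
  Υnu-S₄⇒g≡ε⊎g≡y {x = x} {y} υ = ≡⊎≡-by-exclusion (_≟K_ m) (λ g → S₀ m x y ↭ S₄ m g x y) S₀↭S₄ε S₀↭S₄y
    λ g≢ε g≢y → Υnu⇒¬OnlyTermOfMult υ y (S₄-onlyTermOfMult g≢ε g≢y)

  Υnu-S₅⇒g≡ε⊎g≡x : ∀ {g x y} → Υnu m (S₅ m g x y) → (g ≡ ε ⊎ g ≡ x) × (S₀ m x y ↭ S₅ m g x y)
  Υnu-S₅⇒g≡ε⊎g≡x {x = x} {y} υ = ≡⊎≡-by-exclusion (_≟K_ m) (λ g → S₀ m x y ↭ S₅ m g x y) S₀↭S₅ε S₀↭S₅x
    λ g≢ε g≢x → Υnu⇒¬OnlyTermOfMult υ x (OnlyTermOfMult-resp-↭ S₅↭S₄ (S₄-onlyTermOfMult g≢ε g≢x))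

lemma3p3 : (m : ℕ) .{{_ : NonZero m}} → 4 ≤ m → (g f₁ f₂ : K m) →
    Υnu m (S₀ m f₁ f₂) →
    ((Υnu m (S₁ m g f₁ f₂) → (g ≡ 0K m) × (S₀ m f₁ f₂ ↭ S₁ m g f₁ f₂))
    × (Υnu m (S₂ m g f₁ f₂) → (g ≡ 0K m) × (S₀ m f₁ f₂ ↭ S₂ m g f₁ f₂))
    × (Υnu m (S₃ m g f₁ f₂) → ((g ≡ 0K m) ⊎ (g ≡ _⊕_ m (⊖_ m f₁) f₂)) × (S₀ m f₁ f₂ ↭ S₃ m g f₁ f₂))
    × (Υnu m (S₄ m g f₁ f₂) → ((g ≡ 0K m) ⊎ (g ≡ f₂)) × (S₀ m f₁ f₂ ↭ S₄ m g f₁ f₂))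
    × (Υnu m (S₅ m g f₁ f₂) → ((g ≡ 0K m) ⊎ (g ≡ f₁)) × (S₀ m f₁ f₂ ↭ S₅ m g f₁ f₂)))
lemma3p3 _ (s≤s (s≤s (s≤s (s≤s {n = k} z≤n)))) g f₁ f₂ ((minimal , _) , _) =
    Υnu-S₁⇒g≡ε minimal , Υnu-S₂⇒g≡ε minimal , Υnu-S₃⇒g≡ε⊎g≡x⁻¹∙y minimal
  , Υnu-S₄⇒g≡ε⊎g≡y , Υnu-S₅⇒g≡ε⊎g≡x
  where open Modifications k
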